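{- Let $k\ge2$, let $x^*$ and $x$ be $2k$-NN graphs on $[n]$, and let $G$ be their difference graph. For each red edge $e$ of $G$ there exists a red edge $f$ of $G$, distinct from $e$, such that $e$ and $f$ are nearby, i.e. $d(e,f)\le 2k$.
   Context: For a permutation $\sigma$ of $[n]$, the $2k$-NN graph associated with $\sigma$ is the graph on $[n]$ in which $i\ne j$ are adjacent iff $d_\sigma(i,j)\le k$, where $d_\sigma(i,j)=\min\{|\sigma^{ -1}(i)-\sigma^{ -1}(j)|,n-|\sigma^{ -1}(i)-\sigma^{ -1}(j)|\}$ is the distance along the Hamiltonian cycle $(\sigma(1),\dots,\sigma(n),\sigma(1))$. Let $x^*$ be associated with $\sigma^*$ and write $d_{x^*}=d_{\sigma^*}$. The difference graph $G=G(x)$ is the bi-colored graph on $[n]$ whose red edges are the edges of $x^*$ not in $x$ and whose blue edges are the edges of $x$ not in $x^*$. For edges $e=(i,\tilde i)$ and $f=(j,\tilde j)$, $d(e,f)=\min\{d_{x^*}(i,j),d_{x^*}(i,\tilde j),d_{x^*}(\tilde i,j),d_{x^*}(\tilde i,\tilde j)\}$. -}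

module Defs where

open import Data.Nat using (ℕ; _∸_; _⊓_; ∣_-_∣; _≤_; _*_)
open import Data.Fin using (Fin; toℕ)
open import Data.Fin.Permutation using (Permutation′; _⟨$⟩ˡ_)
open import Data.Product using (_×_; ∃-syntax)
open import Relation.Binary.PropositionalEquality using (_≡_; _≢_)
open import Relation.Nullary using (¬_)
open import Data.Sum using (_⊎_)

-- Vertex set [n] is represented by Fin n; positions along the Hamiltonian
-- cycle are 0-indexed (Fin n), which does not affect differences.
-- σ maps positions to vertices; σ⁻¹ i = σ ⟨$⟩ˡ i is the position of vertex i.

dist : ∀ {n} → Permutation′ n → Fin n → Fin n → ℕ
dist {n} σ i j = δ ⊓ (n ∸ δ)
  where δ = ∣ toℕ (σ ⟨$⟩ˡ i) - toℕ (σ ⟨$⟩ˡ j) ∣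

NNAdj : ∀ {n} → ℕ → Permutation′ n → Fin n → Fin n → Set
NNAdj k σ i j = (i ≢ j) × (dist σ i j ≤ k)

-- red edges of the difference graph G(x): edges of x* (assoc. with σ*) not in x (assoc. with σ)
Red : ∀ {n} → ℕ → (σ* σ : Permutation′ n) → Fin n → Fin n → Set
Red k σ* σ i j = NNAdj k σ* i j × ¬ NNAdj k σ i j

SameEdge : ∀ {n} → Fin n → Fin n → Fin n → Fin n → Set
SameEdge i i' j j' = ((i ≡ j) × (i' ≡ j')) ⊎ ((i ≡ j') × (i' ≡ j))

edgeDist : ∀ {n} → Permutation′ n → Fin n → Fin n → Fin n → Fin n → ℕ
edgeDist σ* i i' j j' =
  (dist σ* i j ⊓ dist σ* i j') ⊓ (dist σ* i' j ⊓ dist σ* i' j')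

module Submission where

-- Suppose the red edge e = {i,i'} had no other red edge
-- within distance 2k.  Then every edge of x* near e other than e itself is
-- also an edge of x.  Both graphs are 2k-regular, so counting neighbourhoods
-- gives: (1) i has a new x-neighbour w with {i,w} not in x*; (2) since i lost
-- only i', every other x-neighbour of i is an x*-neighbour.  Take a common
-- x-neighbour c of i and w (it exists because n ≥ 2k+2 and k ≥ 2).  By (2),
-- c is an x*-neighbour of i, so the x*-edges at c survive, and counting again
-- shows {c,w} ∈ x*.  By the triangle inequality d_{x*}(i,w) ≤ 2k, so the
-- x*-edges at w survive too, and counting forces {w,i} ∈ x*: contradiction.

open import Defs
open import Data.Nat using (ℕ; zero; suc; _+_; _*_; _∸_; _⊓_; ∣_-_∣; _≤_; _<_; _≤?_; _<?_; z≤n; s≤s; s≤s⁻¹)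
import Data.Nat as ℕ
open import Data.Nat.Properties
open import Data.Fin using (Fin; toℕ; fromℕ<; fromℕ; inject₁) renaming (zero to fzero; suc to fsuc)
import Data.Fin as F
open import Data.Fin.Properties using (toℕ-injective; toℕ<n; toℕ-fromℕ<; toℕ-fromℕ; toℕ-inject₁; any?) renaming (suc-injective to fsuc-injective)
open import Data.Fin.Permutation using (Permutation′; _⟨$⟩ˡ_; _⟨$⟩ʳ_; inverseˡ; inverseʳ)
open import Data.Product using (_×_; _,_; proj₁; proj₂; ∃-syntax)
open import Data.Sum using (_⊎_; inj₁; inj₂)
open import Data.Empty using (⊥; ⊥-elim)
open import Function using (_∘_)
open import Relation.Binary.PropositionalEquality
open import Relation.Binary.Definitions using (tri<; tri≈; tri>)
open import Relation.Nullary using (¬_; Dec; yes; no; contradiction)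
open import Relation.Nullary.Decidable using (_×-dec_; _⊎-dec_; ¬?; decidable-stable)
open import Relation.Unary using (Decidable)
open import Algebra.Properties.CommutativeMonoid.Sum +-0-commutativeMonoid
  using (sum; sum-permute; sum-cong-≗; ∑-distrib-+; sum-init-last; sum-replicate-zero)
open import Algebra.Properties.CommutativeSemigroup +-commutativeSemigroup
  using (xy∙z≈xz∙y; xy∙z≈x∙zy)

-- The cyclic distance on positions 0 … N-1.

module Cyclic (N : ℕ) where
  open ≤-Reasoning

  -- the distance of Defs.dist, on positions: dist σ u v ≡ cd (pos u) (pos v)
  cd : ℕ → ℕ → ℕ
  cd a b = ∣ a - b ∣ ⊓ (N ∸ ∣ a - b ∣)

  cd-sym : ∀ a b → cd a b ≡ cd b a
  cd-sym a b rewrite ∣-∣-comm a b = refl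

  cd+cd≤N : ∀ {a b} → a ≤ N → b ≤ N → cd a b + cd a b ≤ N
  cd+cd≤N {a} {b} a≤N b≤N = begin
      cd a b + cd a b                ≤⟨ +-mono-≤ (m⊓n≤m ∣ a - b ∣ _) (m⊓n≤n ∣ a - b ∣ _) ⟩
      ∣ a - b ∣ + (N ∸ ∣ a - b ∣)    ≡⟨ m+[n∸m]≡n (≤-trans (∣m-n∣≤m⊔n a b) (⊔-lub a≤N b≤N)) ⟩
      N                              ∎

  -- `Near d a b` is `cd a b ≤ d` in linear form: a and b are within d of
  -- each other either directly or around the end of the cycle.
  Near : ℕ → ℕ → ℕ → Set
  Near d a b = (a ≤ b + d × b ≤ a + d) ⊎ (a + N ≤ b + d) ⊎ (b + N ≤ a + d)

  Near-sym : ∀ {d a b} → Near d a b → Near d b a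
  Near-sym (inj₁ (p , q))  = inj₁ (q , p)
  Near-sym (inj₂ (inj₁ p)) = inj₂ (inj₂ p)
  Near-sym (inj₂ (inj₂ p)) = inj₂ (inj₁ p)

  near-≤ : ∀ {d a b} → a ≤ b → b ≤ a + d → Near d a b
  near-≤ {d} {a} {b} a≤b b≤a+d = inj₁ (≤-trans a≤b (m≤m+n b d) , b≤a+d)

  private
    b≡a+∣a-b∣ : ∀ {a b} → a ≤ b → b ≡ a + ∣ a - b ∣
    b≡a+∣a-b∣ {a} a≤b = trans (sym (m+[n∸m]≡n a≤b)) (cong (a +_) (sym (m≤n⇒∣m-n∣≡n∸m a≤b)))

    cd≤⇒Near-≤ : ∀ {d a b} → a ≤ b → cd a b ≤ d → Near d a b
    cd≤⇒Near-≤ {d} {a} {b} a≤b h with ⊓-sel ∣ a - b ∣ (N ∸ ∣ a - b ∣)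
    ... | inj₁ cd≡δ = near-≤ a≤b (begin
          b               ≡⟨ b≡a+∣a-b∣ a≤b ⟩
          a + ∣ a - b ∣   ≤⟨ +-monoʳ-≤ a (subst (_≤ d) cd≡δ h) ⟩
          a + d           ∎)
    ... | inj₂ cd≡N-δ = inj₂ (inj₁ (begin
          a + N                               ≤⟨ +-monoʳ-≤ a (m≤n+m∸n N ∣ a - b ∣) ⟩
          a + (∣ a - b ∣ + (N ∸ ∣ a - b ∣))   ≤⟨ +-monoʳ-≤ a (+-monoʳ-≤ ∣ a - b ∣ (subst (_≤ d) cd≡N-δ h)) ⟩
          a + (∣ a - b ∣ + d)                 ≡⟨ sym (+-assoc a _ d) ⟩
          (a + ∣ a - b ∣) + d                 ≡⟨ cong (_+ d) (sym (b≡a+∣a-b∣ a≤b)) ⟩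
          b + d                               ∎))

    Near⇒cd≤-≤ : ∀ {d a b} → a ≤ b → Near d a b → cd a b ≤ d
    Near⇒cd≤-≤ {d} {a} {b} a≤b (inj₁ (_ , b≤a+d)) =
      ≤-trans (m⊓n≤m _ _) (subst (_≤ d) (sym (m≤n⇒∣m-n∣≡n∸m a≤b)) (m≤n+o⇒m∸n≤o b a b≤a+d))
    Near⇒cd≤-≤ {d} {a} {b} a≤b (inj₂ (inj₁ h)) =
      ≤-trans (m⊓n≤n _ _) (m≤n+o⇒m∸n≤o N ∣ a - b ∣ (+-cancelˡ-≤ a _ _ (begin
        a + N                ≤⟨ h ⟩
        b + d                ≡⟨ cong (_+ d) (b≡a+∣a-b∣ a≤b) ⟩
        (a + ∣ a - b ∣) + d  ≡⟨ +-assoc a _ d ⟩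
        a + (∣ a - b ∣ + d)  ∎)))
    Near⇒cd≤-≤ {d} {a} {b} a≤b (inj₂ (inj₂ h)) =
      ≤-trans (m⊓n≤n _ _) (≤-trans (m∸n≤m N ∣ a - b ∣) (+-cancelˡ-≤ b _ _ (≤-trans h (+-monoˡ-≤ d a≤b))))

  cd≤⇒Near : ∀ {d} a b → cd a b ≤ d → Near d a b
  cd≤⇒Near a b h with ≤-total a b
  ... | inj₁ a≤b = cd≤⇒Near-≤ a≤b h
  ... | inj₂ b≤a = Near-sym (cd≤⇒Near-≤ b≤a (subst (_≤ _) (cd-sym a b) h))

  Near⇒cd≤ : ∀ {d} a b → Near d a b → cd a b ≤ d
  Near⇒cd≤ a b h with ≤-total a b
  ... | inj₁ a≤b = Near⇒cd≤-≤ a≤b h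
  ... | inj₂ b≤a = subst (_≤ _) (cd-sym b a) (Near⇒cd≤-≤ b≤a (Near-sym h))

  Near-trans : ∀ {d₁ d₂ a b c} → a ≤ N → b ≤ N → c ≤ N →
               Near d₁ a b → Near d₂ b c → Near (d₁ + d₂) a c
  Near-trans {d₁} {d₂} {a} {b} {c} _ _ _ (inj₁ (ab , ba)) (inj₁ (bc , cb)) = inj₁
    ( (begin a ≤⟨ ab ⟩ b + d₁ ≤⟨ +-monoˡ-≤ d₁ bc ⟩ (c + d₂) + d₁ ≡⟨ xy∙z≈x∙zy c d₂ d₁ ⟩ c + (d₁ + d₂) ∎)
    , (begin c ≤⟨ cb ⟩ b + d₂ ≤⟨ +-monoˡ-≤ d₂ ba ⟩ (a + d₁) + d₂ ≡⟨ +-assoc a d₁ d₂ ⟩ a + (d₁ + d₂) ∎))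
  Near-trans {d₁} {d₂} {a} {b} {c} _ _ _ (inj₁ (ab , _)) (inj₂ (inj₁ h)) = inj₂ (inj₁ (begin
    a + N ≤⟨ +-monoˡ-≤ N ab ⟩ (b + d₁) + N ≡⟨ xy∙z≈xz∙y b d₁ N ⟩ (b + N) + d₁
          ≤⟨ +-monoˡ-≤ d₁ h ⟩ (c + d₂) + d₁ ≡⟨ xy∙z≈x∙zy c d₂ d₁ ⟩ c + (d₁ + d₂) ∎))
  Near-trans {d₁} {d₂} {a} {b} {c} _ _ _ (inj₁ (_ , ba)) (inj₂ (inj₂ h)) = inj₂ (inj₂ (begin
    c + N ≤⟨ h ⟩ b + d₂ ≤⟨ +-monoˡ-≤ d₂ ba ⟩ (a + d₁) + d₂ ≡⟨ +-assoc a d₁ d₂ ⟩ a + (d₁ + d₂) ∎))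
  Near-trans {d₁} {d₂} {a} {b} {c} _ _ _ (inj₂ (inj₁ h)) (inj₁ (bc , _)) = inj₂ (inj₁ (begin
    a + N ≤⟨ h ⟩ b + d₁ ≤⟨ +-monoˡ-≤ d₁ bc ⟩ (c + d₂) + d₁ ≡⟨ xy∙z≈x∙zy c d₂ d₁ ⟩ c + (d₁ + d₂) ∎))
  Near-trans {d₁} {d₂} {a} {b} {c} _ _ _ (inj₂ (inj₁ h)) (inj₂ (inj₁ h′)) = inj₂ (inj₁ (begin
    a + N ≤⟨ h ⟩ b + d₁ ≤⟨ +-monoˡ-≤ d₁ (≤-trans (m≤m+n b N) h′) ⟩ (c + d₂) + d₁
          ≡⟨ xy∙z≈x∙zy c d₂ d₁ ⟩ c + (d₁ + d₂) ∎))
  Near-trans {d₁} {d₂} {a} {b} {c} _ b≤N _ (inj₂ (inj₁ h)) (inj₂ (inj₂ h′)) =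
    inj₁ (≤-trans a≤d₁ (≤-trans (m≤m+n d₁ d₂) (m≤n+m _ c)) , ≤-trans c≤d₂ (≤-trans (m≤n+m d₂ d₁) (m≤n+m _ a)))
    where
      -- both a and c lie below the wrapping distance, so they are directly near
      a≤d₁ : a ≤ d₁
      a≤d₁ = +-cancelʳ-≤ N a d₁ (begin a + N ≤⟨ h ⟩ b + d₁ ≤⟨ +-monoˡ-≤ d₁ b≤N ⟩ N + d₁ ≡⟨ +-comm N d₁ ⟩ d₁ + N ∎)
      c≤d₂ : c ≤ d₂
      c≤d₂ = +-cancelʳ-≤ N c d₂ (begin c + N ≤⟨ h′ ⟩ b + d₂ ≤⟨ +-monoˡ-≤ d₂ b≤N ⟩ N + d₂ ≡⟨ +-comm N d₂ ⟩ d₂ + N ∎)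
  Near-trans {d₁} {d₂} {a} {b} {c} _ _ _ (inj₂ (inj₂ h)) (inj₁ (_ , cb)) = inj₂ (inj₂ (begin
    c + N ≤⟨ +-monoˡ-≤ N cb ⟩ (b + d₂) + N ≡⟨ xy∙z≈xz∙y b d₂ N ⟩ (b + N) + d₂
          ≤⟨ +-monoˡ-≤ d₂ h ⟩ (a + d₁) + d₂ ≡⟨ +-assoc a d₁ d₂ ⟩ a + (d₁ + d₂) ∎))
  Near-trans {d₁} {d₂} {a} {b} {c} a≤N _ c≤N (inj₂ (inj₂ h)) (inj₂ (inj₁ h′)) = inj₁
    ( (begin a ≤⟨ a≤N ⟩ N ≤⟨ m≤n+m N b ⟩ b + N ≤⟨ h′ ⟩ c + d₂ ≤⟨ +-monoʳ-≤ c (m≤n+m d₂ d₁) ⟩ c + (d₁ + d₂) ∎)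
    , (begin c ≤⟨ c≤N ⟩ N ≤⟨ m≤n+m N b ⟩ b + N ≤⟨ h ⟩ a + d₁ ≤⟨ +-monoʳ-≤ a (m≤m+n d₁ d₂) ⟩ a + (d₁ + d₂) ∎))
  Near-trans {d₁} {d₂} {a} {b} {c} _ _ _ (inj₂ (inj₂ h)) (inj₂ (inj₂ h′)) = inj₂ (inj₂ (begin
    c + N ≤⟨ h′ ⟩ b + d₂ ≤⟨ +-monoˡ-≤ d₂ (m≤m+n b N) ⟩ (b + N) + d₂
          ≤⟨ +-monoˡ-≤ d₂ h ⟩ (a + d₁) + d₂ ≡⟨ +-assoc a d₁ d₂ ⟩ a + (d₁ + d₂) ∎))

  cd-triangle : ∀ {a b c} → a ≤ N → b ≤ N → c ≤ N → cd a c ≤ cd a b + cd b c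
  cd-triangle {a} {b} {c} a≤N b≤N c≤N =
    Near⇒cd≤ a c (Near-trans a≤N b≤N c≤N (cd≤⇒Near a b ≤-refl) (cd≤⇒Near b c ≤-refl))

  -- adjacency of positions in the 2k-NN graph of the identity ordering
  RingAdj : ℕ → ℕ → ℕ → Set
  RingAdj k p q = q ≢ p × cd p q ≤ k

  RingAdj? : ∀ k p q → Dec (RingAdj k p q)
  RingAdj? k p q = ¬? (q ℕ.≟ p) ×-dec (cd p q ≤? k)

  CommonNeighbour : ℕ → ℕ → ℕ → Set
  CommonNeighbour k a b = ∃[ q ] (q < N × q ≢ a × q ≢ b × Near k a q × Near k b q)

  private
    a+1≤a+k : ∀ {a k} → 2 ≤ k → suc a ≤ a + k
    a+1≤a+k {a} 2≤k = m<m+n a (≤-trans (s≤s z≤n) 2≤k)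

    a+2≤a+k : ∀ {a k} → 2 ≤ k → suc (suc a) ≤ a + k
    a+2≤a+k {a} {k} 2≤k = subst (_≤ a + k) (+-comm a 2) (+-monoʳ-≤ a 2≤k)

    -- the common neighbour for a < b: step from a towards b, or away from b
    -- when b is the successor of a; when the pair wraps around, step from a
    -- backwards, or from b forwards when a = 0
    common-neighbour< : ∀ {k a b} → 2 ≤ k → 3 ≤ N → k < N → a < b → b < N →
                        Near k a b → CommonNeighbour k a b
    common-neighbour< {k} {a} {b} 2≤k _ _ a<b b<N (inj₁ (_ , b≤a+k)) with m≤n⇒m<n∨m≡n a<b
    ... | inj₁ a+1<b = suc a , <-trans a+1<b b<N , 1+n≢n , <⇒≢ a+1<b
          , near-≤ (n≤1+n a) (a+1≤a+k 2≤k)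
          , Near-sym (near-≤ (<⇒≤ a+1<b) (≤-trans b≤a+k (+-monoˡ-≤ k (n≤1+n a))))
    ... | inj₂ refl with suc (suc a) <? N
    ...   | yes a+2<N = suc (suc a) , a+2<N , >⇒≢ (≤-trans (n<1+n a) (n≤1+n _)) , 1+n≢n
          , near-≤ (≤-trans (n≤1+n a) (n≤1+n _)) (a+2≤a+k 2≤k)
          , near-≤ (n≤1+n _) (a+1≤a+k 2≤k)
    common-neighbour< {k} {zero} 2≤k 3≤N _ _ _ (inj₁ _) | inj₂ refl | no 2≮N = ⊥-elim (2≮N 3≤N)
    common-neighbour< {k} {suc a} 2≤k _ _ a<b b<N (inj₁ _) | inj₂ refl | no _ =
          a , <-trans (n<1+n a) (<-trans a<b b<N) , <⇒≢ (n<1+n a) , <⇒≢ (≤-trans (n<1+n a) (n≤1+n _))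
          , Near-sym (near-≤ (n≤1+n a) (a+1≤a+k 2≤k))
          , Near-sym (near-≤ (≤-trans (n≤1+n a) (n≤1+n _)) (a+2≤a+k 2≤k))
    common-neighbour< {k} {suc a} {b} 2≤k _ _ a<b b<N (inj₂ (inj₁ h)) =
          a , <-trans (n<1+n a) (<-trans a<b b<N) , <⇒≢ (n<1+n a) , <⇒≢ (<-trans (n<1+n a) a<b)
          , Near-sym (near-≤ (n≤1+n a) (a+1≤a+k 2≤k))
          , Near-sym (inj₂ (inj₁ (≤-trans (+-monoˡ-≤ N (n≤1+n a)) h)))
    common-neighbour< {k} {zero} {b} 2≤k 3≤N _ _ b<N (inj₂ (inj₁ h)) with suc b <? N
    ... | yes b+1<N = suc b , b+1<N , (λ ()) , 1+n≢n
          , inj₂ (inj₁ (≤-trans h (+-monoˡ-≤ k (n≤1+n b))))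
          , near-≤ (n≤1+n b) (a+1≤a+k 2≤k)
    ... | no b+1≮N = 1 , ≤-trans (s≤s (s≤s z≤n)) 3≤N , (λ ()) , <⇒≢ 1<b
          , near-≤ z≤n (≤-trans (s≤s z≤n) 2≤k)
          , inj₂ (inj₂ (subst (λ m → 1 + m ≤ b + k) b+1≡N (a+2≤a+k 2≤k)))
      where
        b+1≡N : suc b ≡ N
        b+1≡N = ≤-antisym b<N (≮⇒≥ b+1≮N)
        1<b : 1 < b
        1<b = s≤s⁻¹ (subst (3 ≤_) (sym b+1≡N) 3≤N)
    common-neighbour< {k} {a} {b} _ _ k<N a<b _ (inj₂ (inj₂ h)) =
      ⊥-elim (<-irrefl refl (≤-<-trans h (+-mono-< a<b k<N)))

  common-neighbour : ∀ {k a b} → 2 ≤ k → 3 ≤ N → k < N → a < N → b < N →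
                     RingAdj k a b → ∃[ q ] (q < N × RingAdj k a q × RingAdj k b q)
  common-neighbour {k} {a} {b} 2≤k 3≤N k<N a<N b<N (b≢a , cd≤k) with <-cmp a b
  ... | tri≈ _ a≡b _ = ⊥-elim (b≢a (sym a≡b))
  ... | tri< a<b _ _ with common-neighbour< 2≤k 3≤N k<N a<b b<N (cd≤⇒Near a b cd≤k)
  ...   | q , q<N , q≢a , q≢b , aq , bq = q , q<N , (q≢a , Near⇒cd≤ a q aq) , (q≢b , Near⇒cd≤ b q bq)
  common-neighbour {k} {a} {b} 2≤k 3≤N k<N a<N b<N (b≢a , cd≤k) | tri> _ _ b<a
    with common-neighbour< 2≤k 3≤N k<N b<a a<N (Near-sym (cd≤⇒Near a b cd≤k))
  ... | q , q<N , q≢b , q≢a , bq , aq = q , q<N , (q≢a , Near⇒cd≤ a q aq) , (q≢b , Near⇒cd≤ b q bq)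

-- Counting elements of decidable subsets of Fin m.

bit : ∀ {a} {A : Set a} → Dec A → ℕ
bit (yes _) = 1
bit (no _)  = 0

bit-yes : ∀ {a} {A : Set a} → A → (A? : Dec A) → bit A? ≡ 1
bit-yes _ (yes _) = refl
bit-yes x (no ¬x) = ⊥-elim (¬x x)

bit-no : ∀ {a} {A : Set a} → ¬ A → (A? : Dec A) → bit A? ≡ 0
bit-no ¬x (yes x) = ⊥-elim (¬x x)
bit-no _  (no _)  = refl

bit≤1 : ∀ {a} {A : Set a} (A? : Dec A) → bit A? ≤ 1
bit≤1 (yes _) = ≤-refl
bit≤1 (no _)  = z≤n

bit-mono : ∀ {a b} {A : Set a} {B : Set b} → (A → B) → (A? : Dec A) (B? : Dec B) → bit A? ≤ bit B?
bit-mono _ (yes _) (yes _) = ≤-refl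
bit-mono f (yes x) (no ¬y) = ⊥-elim (¬y (f x))
bit-mono _ (no _)  _       = z≤n

bit-cong : ∀ {a b} {A : Set a} {B : Set b} → (A → B) → (B → A) → (A? : Dec A) (B? : Dec B) → bit A? ≡ bit B?
bit-cong f g A? B? = ≤-antisym (bit-mono f A? B?) (bit-mono g B? A?)

count : ∀ {m} {P : Fin m → Set} → Decidable P → ℕ
count P? = sum (λ j → bit (P? j))

δ : ∀ {m} → Fin m → Fin m → ℕ
δ a j = bit (j F.≟ a)

sum-δ : ∀ {m} (a : Fin m) → sum (δ a) ≡ 1
sum-δ {suc m} fzero = cong suc (trans (sum-cong-≗ {m} (λ j → bit-no (λ ()) (fsuc j F.≟ fzero))) (sum-replicate-zero m))
sum-δ {suc m} (fsuc a) = begin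
    δ (fsuc a) fzero + sum (λ j → δ (fsuc a) (fsuc j))
      ≡⟨ cong₂ _+_ (bit-no (λ ()) (fzero F.≟ fsuc a))
                   (sum-cong-≗ {m} (λ j → bit-cong fsuc-injective (cong fsuc) (fsuc j F.≟ fsuc a) (j F.≟ a))) ⟩
    sum (δ a) ≡⟨ sum-δ a ⟩
    1         ∎
  where open ≡-Reasoning

sum-mono : ∀ {m} (f g : Fin m → ℕ) → (∀ j → f j ≤ g j) → sum f ≤ sum g
sum-mono {zero}  f g f≤g = z≤n
sum-mono {suc m} f g f≤g = +-mono-≤ (f≤g fzero) (sum-mono (f ∘ fsuc) (g ∘ fsuc) (f≤g ∘ fsuc))

sum-excess : ∀ {m} (f g e e′ : Fin m → ℕ) → sum f ≡ sum g →
             (∀ j → f j + e j ≤ g j + e′ j) → sum e ≤ sum e′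
sum-excess f g e e′ Σf≡Σg pointwise = +-cancelˡ-≤ (sum f) _ _ (begin
    sum f + sum e               ≡⟨ ∑-distrib-+ f e ⟨
    sum (λ j → f j + e j)       ≤⟨ sum-mono _ _ pointwise ⟩
    sum (λ j → g j + e′ j)      ≡⟨ ∑-distrib-+ g e′ ⟩
    sum g + sum e′              ≡⟨ cong (_+ sum e′) Σf≡Σg ⟨
    sum f + sum e′              ∎)
  where open ≤-Reasoning

module SameSize {m} {P Q : Fin m → Set} (P? : Decidable P) (Q? : Decidable Q)
                (same-size : count P? ≡ count Q?) where

  ⊆⇒⊇ : (∀ v → P v → Q v) → ∀ v → Q v → P v
  ⊆⇒⊇ P⊆Q v Qv with P? v
  ... | yes Pv = Pv
  ... | no ¬Pv = contradiction
        (subst₂ _≤_ (sum-δ v) (sum-replicate-zero m)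
          (sum-excess (λ j → bit (P? j)) (λ j → bit (Q? j)) (δ v) (λ _ → 0) same-size pointwise))
        λ ()
    where
      pointwise : ∀ j → bit (P? j) + δ v j ≤ bit (Q? j) + 0
      pointwise j with j F.≟ v
      ... | yes refl rewrite bit-no ¬Pv (P? j) | bit-yes Qv (Q? j) = ≤-refl
      ... | no _ = +-monoˡ-≤ 0 (bit-mono (P⊆Q j) (P? j) (Q? j))

  exchange : ∀ {t w c} → (∀ v → v ≢ t → P v → Q v) → P t →
             Q w → ¬ P w → Q c → c ≢ w → P c
  exchange {t} {w} {c} keep Pt Qw ¬Pw Qc c≢w with P? c
  ... | yes Pc = Pc
  ... | no ¬Pc = contradiction
        (subst₂ _≤_ (trans (∑-distrib-+ (δ w) (δ c)) (cong₂ _+_ (sum-δ w) (sum-δ c))) (sum-δ t)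
          (sum-excess (λ j → bit (P? j)) (λ j → bit (Q? j)) (λ j → δ w j + δ c j) (δ t) same-size pointwise))
        λ { (s≤s ()) }
    where
      t≢w : t ≢ w
      t≢w t≡w = ¬Pw (subst P t≡w Pt)
      t≢c : t ≢ c
      t≢c t≡c = ¬Pc (subst P t≡c Pt)

      pointwise : ∀ j → bit (P? j) + (δ w j + δ c j) ≤ bit (Q? j) + δ t j
      pointwise j with j F.≟ t
      ... | yes refl rewrite bit-no t≢w (j F.≟ w) | bit-no t≢c (j F.≟ c) | +-identityʳ (bit (P? j)) =
            ≤-trans (bit≤1 (P? j)) (m≤n+m 1 _)
      ... | no j≢t with j F.≟ w
      ...   | yes refl rewrite bit-no ¬Pw (P? j) | bit-yes Qw (Q? j) | bit-no (c≢w ∘ sym) (j F.≟ c) = ≤-refl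
      ...   | no _ with j F.≟ c
      ...     | yes refl rewrite bit-no ¬Pc (P? j) | bit-yes Qc (Q? j) = ≤-refl
      ...     | no j≢c = +-monoˡ-≤ 0 (bit-mono (keep j j≢t) (P? j) (Q? j))

-- Regularity of 2k-NN graphs.

ringDegree : ℕ → ℕ → ℕ → ℕ
ringDegree N k p = count (λ (q : Fin N) → Cyclic.RingAdj? N k p (toℕ q))

-- rotating the cycle by one step: position p+1 sees 0 where p sees M = N-1,
-- and q+1 where p sees q
ringDegree-rotate : ∀ M k p → p < M → ringDegree (suc M) k (suc p) ≡ ringDegree (suc M) k p
ringDegree-rotate M k p p<M = begin
    bit (RingAdj? k (suc p) 0) + sum (λ (q : Fin M) → bit (RingAdj? k (suc p) (suc (toℕ q))))
      ≡⟨ cong₂ _+_ wrap (sum-cong-≗ {M} shift) ⟩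
    bit (RingAdj? k p M) + sum (λ (q : Fin M) → bit (RingAdj? k p (toℕ q)))
      ≡⟨ +-comm (bit (RingAdj? k p M)) _ ⟩
    sum (λ (q : Fin M) → bit (RingAdj? k p (toℕ q))) + bit (RingAdj? k p M)
      ≡⟨ cong₂ _+_ (sum-cong-≗ {M} (λ q → cong (bit ∘ RingAdj? k p) (sym (toℕ-inject₁ q))))
                   (cong (bit ∘ RingAdj? k p) (sym (toℕ-fromℕ M))) ⟩
    sum (λ (q : Fin M) → bit (RingAdj? k p (toℕ (inject₁ q)))) + bit (RingAdj? k p (toℕ (fromℕ M)))
      ≡⟨ sum-init-last {M} (λ q → bit (RingAdj? k p (toℕ q))) ⟨
    ringDegree (suc M) k p ∎
  where
    open ≡-Reasoning
    open Cyclic (suc M) using (cd; RingAdj?)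
    cd-wrap : cd (suc p) 0 ≡ cd p M
    cd-wrap = begin
        suc p ⊓ (M ∸ p)                   ≡⟨ ⊓-comm (suc p) (M ∸ p) ⟩
        (M ∸ p) ⊓ suc p                   ≡⟨ cong₂ _⊓_ (sym ∣p-M∣≡M∸p) (sym M+1∸[M∸p]≡p+1) ⟩
        ∣ p - M ∣ ⊓ (suc M ∸ (M ∸ p))     ≡⟨ cong (λ x → ∣ p - M ∣ ⊓ (suc M ∸ x)) (sym ∣p-M∣≡M∸p) ⟩
        cd p M                            ∎
      where
        ∣p-M∣≡M∸p : ∣ p - M ∣ ≡ M ∸ p
        ∣p-M∣≡M∸p = m≤n⇒∣m-n∣≡n∸m (<⇒≤ p<M)
        M+1∸[M∸p]≡p+1 : suc M ∸ (M ∸ p) ≡ suc p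
        M+1∸[M∸p]≡p+1 = trans (+-∸-assoc 1 (m∸n≤m M p)) (cong suc (m∸[m∸n]≡n (<⇒≤ p<M)))

    wrap : bit (RingAdj? k (suc p) 0) ≡ bit (RingAdj? k p M)
    wrap = bit-cong (λ (_ , d) → >⇒≢ p<M , subst (_≤ k) cd-wrap d)
                    (λ (_ , d) → (λ ()) , subst (_≤ k) (sym cd-wrap) d)
                    (RingAdj? k (suc p) 0) (RingAdj? k p M)

    shift : ∀ (q : Fin M) → bit (RingAdj? k (suc p) (suc (toℕ q))) ≡ bit (RingAdj? k p (toℕ q))
    shift q = bit-cong (λ (ne , d) → ne ∘ cong suc , d) (λ (ne , d) → ne ∘ suc-injective , d)
                       (RingAdj? k (suc p) (suc (toℕ q))) (RingAdj? k p (toℕ q))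

ringDegree-constant : ∀ N k p → p < N → ringDegree N k p ≡ ringDegree N k 0
ringDegree-constant N       k zero    _   = refl
ringDegree-constant (suc M) k (suc p) p+1<N =
  trans (ringDegree-rotate M k p (s≤s⁻¹ p+1<N)) (ringDegree-constant (suc M) k p (<-trans (n<1+n p) p+1<N))

module NNGraph (n k : ℕ) where
  open Cyclic n using (cd-sym; cd+cd≤N; cd-triangle; common-neighbour; RingAdj; RingAdj?)

  pos : Permutation′ n → Fin n → ℕ
  pos π u = toℕ (π ⟨$⟩ˡ u)

  pos<n : ∀ (π : Permutation′ n) u → pos π u < n
  pos<n π u = toℕ<n (π ⟨$⟩ˡ u)

  pos-injective : ∀ (π : Permutation′ n) {u v} → pos π u ≡ pos π v → u ≡ v
  pos-injective π {u} {v} eq = begin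
      u                       ≡⟨ inverseʳ π ⟨
      π ⟨$⟩ʳ (π ⟨$⟩ˡ u)       ≡⟨ cong (π ⟨$⟩ʳ_) (toℕ-injective eq) ⟩
      π ⟨$⟩ʳ (π ⟨$⟩ˡ v)       ≡⟨ inverseʳ π ⟩
      v                       ∎
    where open ≡-Reasoning

  adj⇒ringAdj : ∀ (π : Permutation′ n) {u v} → NNAdj k π u v → RingAdj k (pos π u) (pos π v)
  adj⇒ringAdj π (u≢v , d) = (λ e → u≢v (pos-injective π (sym e))) , d

  ringAdj⇒adj : ∀ (π : Permutation′ n) {u v} → RingAdj k (pos π u) (pos π v) → NNAdj k π u v
  ringAdj⇒adj π (pv≢pu , d) = (λ u≡v → pv≢pu (cong (pos π) (sym u≡v))) , d

  Adj? : (π : Permutation′ n) (u : Fin n) → Decidable (NNAdj k π u)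
  Adj? π u v = ¬? (u F.≟ v) ×-dec (dist π u v ≤? k)

  Red? : ∀ (σ* σ : Permutation′ n) u v → Dec (Red k σ* σ u v)
  Red? σ* σ u v = Adj? σ* u v ×-dec ¬? (Adj? σ u v)

  dist-self : ∀ (π : Permutation′ n) u → dist π u u ≡ 0
  dist-self π u = cong (λ δ → δ ⊓ (n ∸ δ)) (∣n-n∣≡0 (pos π u))

  NNAdj-sym : ∀ (π : Permutation′ n) {u v} → NNAdj k π u v → NNAdj k π v u
  NNAdj-sym π {u} {v} (u≢v , d) = u≢v ∘ sym , subst (_≤ k) (cd-sym (pos π u) (pos π v)) d

  dist-triangle : ∀ (π : Permutation′ n) u c w → dist π u w ≤ dist π u c + dist π c w
  dist-triangle π u c w = cd-triangle (<⇒≤ (pos<n π u)) (<⇒≤ (pos<n π c)) (<⇒≤ (pos<n π w))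

  dist+dist≤n : ∀ (π : Permutation′ n) u v → dist π u v + dist π u v ≤ n
  dist+dist≤n π u v = cd+cd≤N (<⇒≤ (pos<n π u)) (<⇒≤ (pos<n π v))

  degree : Permutation′ n → Fin n → ℕ
  degree π u = count (Adj? π u)

  -- enumerating the neighbours of u along the cycle of π
  degree≡ringDegree : ∀ (π : Permutation′ n) u → degree π u ≡ ringDegree n k (pos π u)
  degree≡ringDegree π u = begin
      sum (λ v → bit (Adj? π u v))                          ≡⟨ sum-permute (λ v → bit (Adj? π u v)) π ⟩
      sum (λ q → bit (Adj? π u (π ⟨$⟩ʳ q)))                 ≡⟨ sum-cong-≗ {n} at-position ⟩
      sum {n} (λ q → bit (RingAdj? k (pos π u) (toℕ q)))    ∎
    where
      open ≡-Reasoning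
      pos-at : ∀ q → pos π (π ⟨$⟩ʳ q) ≡ toℕ q
      pos-at q = cong toℕ (inverseˡ π)

      at-position : ∀ q → bit (Adj? π u (π ⟨$⟩ʳ q)) ≡ bit (RingAdj? k (pos π u) (toℕ q))
      at-position q = bit-cong
        (subst (RingAdj k (pos π u)) (pos-at q) ∘ adj⇒ringAdj π)
        (ringAdj⇒adj π ∘ subst (RingAdj k (pos π u)) (sym (pos-at q)))
        (Adj? π u (π ⟨$⟩ʳ q)) (RingAdj? k (pos π u) (toℕ q))

  regular : ∀ (π π′ : Permutation′ n) u u′ → degree π u ≡ degree π′ u′
  regular π π′ u u′ = begin
      degree π u                  ≡⟨ degree≡ringDegree π u ⟩
      ringDegree n k (pos π u)    ≡⟨ ringDegree-constant n k _ (pos<n π u) ⟩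
      ringDegree n k 0            ≡⟨ ringDegree-constant n k _ (pos<n π′ u′) ⟨
      ringDegree n k (pos π′ u′)  ≡⟨ degree≡ringDegree π′ u′ ⟨
      degree π′ u′                ∎
    where open ≡-Reasoning

  common-adjacent : ∀ (π : Permutation′ n) {u w} → 2 ≤ k → 3 ≤ n → k < n → NNAdj k π u w →
                    ∃[ c ] (NNAdj k π u c × NNAdj k π w c)
  common-adjacent π {u} {w} 2≤k 3≤n k<n adj
    with common-neighbour 2≤k 3≤n k<n (pos<n π u) (pos<n π w) (adj⇒ringAdj π adj)
  ... | q , q<n , uq , wq = c , adjacent-to-c uq , adjacent-to-c wq
    where
      c : Fin n
      c = π ⟨$⟩ʳ fromℕ< q<n
      pos-c : pos π c ≡ q
      pos-c = trans (cong toℕ (inverseˡ π)) (toℕ-fromℕ< q<n)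
      adjacent-to-c : ∀ {v} → RingAdj k (pos π v) q → NNAdj k π v c
      adjacent-to-c {v} vq = ringAdj⇒adj π (subst (RingAdj k (pos π v)) (sym pos-c) vq)

SameEdge? : ∀ {n} (i i′ j j′ : Fin n) → Dec (SameEdge i i′ j j′)
SameEdge? i i′ j j′ = ((i F.≟ j) ×-dec (i′ F.≟ j′)) ⊎-dec ((i F.≟ j′) ×-dec (i′ F.≟ j))

edgeDist≤dist : ∀ {n} (π : Permutation′ n) i i′ j j′ → edgeDist π i i′ j j′ ≤ dist π i j
edgeDist≤dist π i i′ j j′ = ≤-trans (m⊓n≤m _ _) (m⊓n≤m _ _)

NearbyRed : ∀ {n} → ℕ → (σ* σ : Permutation′ n) (i i′ j j′ : Fin n) → Set
NearbyRed k σ* σ i i′ j j′ = Red k σ* σ j j′ × ¬ SameEdge i i′ j j′ × edgeDist σ* i i′ j j′ ≤ 2 * k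

NearbyRed? : ∀ {n} k (σ* σ : Permutation′ n) (i i′ j j′ : Fin n) → Dec (NearbyRed k σ* σ i i′ j j′)
NearbyRed? {n} k σ* σ i i′ j j′ =
  NNGraph.Red? n k σ* σ j j′ ×-dec ¬? (SameEdge? i i′ j j′) ×-dec (edgeDist σ* i i′ j j′ ≤? 2 * k)

module NoNearbyRedEdge (n k : ℕ) (2≤k : 2 ≤ k) (σ* σ : Permutation′ n) (i i′ : Fin n)
  (red : Red k σ* σ i i′)
  (isolated : ¬ (∃[ j ] ∃[ j′ ] NearbyRed k σ* σ i i′ j j′))
  where
  open NNGraph n k

  i≢i′ : i ≢ i′
  i≢i′ = proj₁ (proj₁ red)

  survives : ∀ {u v} → NNAdj k σ* u v → ¬ SameEdge i i′ u v → edgeDist σ* i i′ u v ≤ 2 * k → NNAdj k σ u v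
  survives {u} {v} adj* ¬same near =
    decidable-stable (Adj? σ u v) (λ ¬adj → isolated (u , v , (adj* , ¬adj) , ¬same , near))

  survives-at-i : ∀ v → v ≢ i′ → NNAdj k σ* i v → NNAdj k σ i v
  survives-at-i v v≢i′ adj* = survives adj* ¬same
    (≤-trans (edgeDist≤dist σ* i i′ i v) (≤-trans (≤-reflexive (dist-self σ* i)) z≤n))
    where
      ¬same : ¬ SameEdge i i′ i v
      ¬same (inj₁ (_ , i′≡v)) = v≢i′ (sym i′≡v)
      ¬same (inj₂ (_ , i′≡i)) = i≢i′ (sym i′≡i)

  -- at a vertex u ∉ e within 2k of i all x*-edges survive; by regularity
  -- the x-neighbourhood of u is then the x*-neighbourhood
  unchanged-near-i : ∀ {u} → u ≢ i → u ≢ i′ → dist σ* i u ≤ 2 * k → ∀ v → NNAdj k σ u v → NNAdj k σ* u v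
  unchanged-near-i {u} u≢i u≢i′ near =
    SameSize.⊆⇒⊇ (Adj? σ* u) (Adj? σ u) (regular σ* σ u u)
      (λ v adj* → survives adj* ¬same (≤-trans (edgeDist≤dist σ* i i′ u v) near))
    where
      ¬same : ∀ {v} → ¬ SameEdge i i′ u v
      ¬same (inj₁ (i≡u , _)) = u≢i (sym i≡u)
      ¬same (inj₂ (_ , i′≡u)) = u≢i′ (sym i′≡u)

  -- since i lost its x*-neighbour i′, it has a new x-neighbour
  new-neighbour : ∃[ w ] (NNAdj k σ i w × ¬ NNAdj k σ* i w)
  new-neighbour with any? (λ w → Adj? σ i w ×-dec ¬? (Adj? σ* i w))
  ... | yes found = found
  ... | no none = ⊥-elim (proj₂ red
        (SameSize.⊆⇒⊇ (Adj? σ i) (Adj? σ* i) (regular σ σ* i i) old i′ (proj₁ red)))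
    where
      old : ∀ v → NNAdj k σ i v → NNAdj k σ* i v
      old v adj = decidable-stable (Adj? σ* i v) (λ ¬adj* → none (v , adj , ¬adj*))

  -- e is not an x-edge, so the cycle has length at least 2k+2
  n-large : suc k + suc k ≤ n
  n-large = ≤-trans (+-mono-≤ k<d k<d) (dist+dist≤n σ i i′)
    where
      k<d : k < dist σ i i′
      k<d = ≰⇒> (λ d≤k → proj₂ red (i≢i′ , d≤k))

  k<n : k < n
  k<n = ≤-trans (m≤m+n (suc k) (suc k)) n-large

  3≤n : 3 ≤ n
  3≤n = ≤-trans (s≤s 2≤k) k<n

  absurd : ⊥
  absurd with new-neighbour
  ... | w , adj-iw , ¬adj*-iw with common-adjacent σ 2≤k 3≤n k<n adj-iw
  ...   | c , adj-ic , adj-wc = ¬adj*-iw (NNAdj-sym σ* adj*-wi)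
    where
      w≢i : w ≢ i
      w≢i = proj₁ adj-iw ∘ sym
      w≢i′ : w ≢ i′
      w≢i′ w≡i′ = ¬adj*-iw (subst (NNAdj k σ* i) (sym w≡i′) (proj₁ red))
      c≢i : c ≢ i
      c≢i = proj₁ adj-ic ∘ sym
      c≢i′ : c ≢ i′
      c≢i′ c≡i′ = proj₂ red (subst (NNAdj k σ i) c≡i′ adj-ic)

      -- w is the only new x-neighbour of i, so c ≠ w is an old one
      adj*-ic : NNAdj k σ* i c
      adj*-ic = SameSize.exchange (Adj? σ* i) (Adj? σ i) (regular σ* σ i i)
                  survives-at-i (proj₁ red) adj-iw ¬adj*-iw adj-ic (proj₁ adj-wc ∘ sym)

      -- c is within k of i, so its neighbourhood is unchanged and contains w
      adj*-cw : NNAdj k σ* c w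
      adj*-cw = unchanged-near-i c≢i c≢i′ (≤-trans (proj₂ adj*-ic) (m≤m+n k _)) w (NNAdj-sym σ adj-wc)

      -- hence w is within 2k of i, so its neighbourhood is unchanged and contains i
      near-iw : dist σ* i w ≤ 2 * k
      near-iw = ≤-trans (dist-triangle σ* i c w)
                  (≤-trans (+-mono-≤ (proj₂ adj*-ic) (proj₂ adj*-cw)) (≤-reflexive (cong (k +_) (sym (+-identityʳ k)))))

      adj*-wi : NNAdj k σ* w i
      adj*-wi = unchanged-near-i w≢i w≢i′ near-iw i (NNAdj-sym σ adj-iw)

-- Nearby red edges form a decidable finite set: either one exists, or the
-- red edge e is isolated, which NoNearbyRedEdge refutes.
lemma2 : (n k : ℕ) → 2 ≤ k → (σ* σ : Permutation′ n) →
    (i i' : Fin n) → Red k σ* σ i i' →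
    ∃[ j ] ∃[ j' ] (Red k σ* σ j j' × ¬ SameEdge i i' j j' × edgeDist σ* i i' j j' ≤ 2 * k)
lemma2 n k 2≤k σ* σ i i' red with any? (λ j → any? (NearbyRed? k σ* σ i i' j))
... | yes found = found
... | no none   = ⊥-elim (NoNearbyRedEdge.absurd n k 2≤k σ* σ i i' red none)
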